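{- For all integers $t\ge 3$ and $k\ge t$, $$\mathrm{rl}_k(D(t-1,t))\ge \frac t2 k^2-P(t)k+Q(t),$$ where $P(t)=t^2-t+1$ and $Q(t)=\frac{t^3}{2}-t^2+\frac32 t-1$.
   Context: For a finite set $D=\{d_1<\dots<d_m\}$ of positive integers, the distance graph $D(d_1,\dots,d_m)$ has vertex set $\mathbb{Z}$, two distinct integers $i,j$ being adjacent iff $|i-j|\in D$. For a connected graph $G$ with graph distance $d(\cdot,\cdot)$ and an integer $k\ge 1$, a radio $k$-labeling of $G$ is a map $c:V(G)\to\mathbb{Z}_{\ge 0}$ such that $|c(u)-c(v)|\geq k+1-d(u,v)$ for all distinct vertices $u,v$. Its span is $\max\{c(x)-c(y): x,y\in V(G)\}$ (a supremum for infinite graphs), and the radio $k$-labeling number $\mathrm{rl}_k(G)$ is the minimum span over all radio $k$-labelings of $G$. -}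

module Defs where

open import Data.Nat as ℕ using (ℕ; zero; suc)
open import Data.Integer as ℤ using (ℤ; +_; ∣_∣)
open import Data.List using (List; _∷_; [])
open import Data.List.Membership.Propositional using (_∈_)
open import Data.Product using (Σ; ∃; _×_; _,_)
open import Relation.Binary.PropositionalEquality using (_≡_; _≢_)

Adjacent : List ℕ → ℤ → ℤ → Set
Adjacent D i j = Σ ℕ λ d → d ∈ D × ∣ i ℤ.- j ∣ ≡ d

data Walk (D : List ℕ) : ℤ → ℤ → ℕ → Set where
  here : ∀ {u} → Walk D u u zero
  step : ∀ {u v w n} → Adjacent D u v → Walk D v w n → Walk D u w (suc n)

IsDist : List ℕ → ℤ → ℤ → ℕ → Set
IsDist D u v n = Walk D u v n × (∀ m → Walk D u v m → n ℕ.≤ m)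

-- Radio k-labeling c : ℤ → ℤ_{≥0} of the distance graph D(…):
-- |c(u) - c(v)| ≥ k + 1 - d(u,v) for all distinct u, v
-- (stated as k + 1 ≤ |c u - c v| + d(u,v) to stay in ℕ).
IsRadioLabeling : List ℕ → ℕ → (ℤ → ℕ) → Set
IsRadioLabeling D k c =
  ∀ u v → u ≢ v → ∀ d → IsDist D u v d →
    k ℕ.+ 1 ℕ.≤ ∣ (+ c u) ℤ.- (+ c v) ∣ ℕ.+ d

SpanAtMost : (ℤ → ℕ) → ℕ → Set
SpanAtMost c M = ∀ x y → c x ℕ.≤ c y ℕ.+ M

-- 2 * ( (t/2) k² - P(t) k + Q(t) ) with P(t) = t² - t + 1,
-- Q(t) = t³/2 - t² + 3t/2 - 1, computed in ℤ.
twiceBound : ℕ → ℕ → ℤ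
twiceBound t k =
  let T = + t ; K = + k in
  T ℤ.* K ℤ.* K
  ℤ.- + 2 ℤ.* (T ℤ.* T ℤ.- T ℤ.+ + 1) ℤ.* K
  ℤ.+ (T ℤ.* T ℤ.* T ℤ.- + 2 ℤ.* T ℤ.* T ℤ.+ + 3 ℤ.* T ℤ.- + 2)

-- A radio k-labeling c of D(s, s+1) satisfies |c u − c v| ≥ k + 1 − d(u,0) − d(0,v) for u ≠ v.
-- Take the 2tR vertices b t + a s (0 ≤ b < R) and −(b t + a s) (1 ≤ b ≤ R), where 0 ≤ a < t;
-- each lies at distance at most a + b from 0.  Listing them by increasing label and summing the
-- consecutive gaps, the span is at least (2tR − 1)(k + 1) − 2W, where W = tR(R + t − 1) is the
-- total of these distance bounds.  For k = t + j and R = ⌊j/2⌋ + 1 this is the claimed bound.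
module Submission where

open import Defs
open import Data.Integer as ℤ using (ℤ; +_; ∣_∣)
import Data.Integer.Properties as ℤP
import Data.Integer.Tactic.RingSolver as ZS
open import Data.List as List using (List; []; _∷_; _++_; length; map)
import Data.List.Properties as Listₚ
open import Data.List.Membership.Propositional using (_∈_; find; lose)
open import Data.List.Relation.Binary.Permutation.Propositional using (↭-sym; ↭⇒↭ₛ)
open import Data.List.Relation.Binary.Permutation.Propositional.Properties
  using (↭-length) renaming (map⁺ to ↭-map⁺)
open import Data.List.Relation.Unary.All as All using (All; []; _∷_)
import Data.List.Relation.Unary.All.Properties as All
open import Data.List.Relation.Unary.AllPairs as AllPairs using (AllPairs; []; _∷_)
import Data.List.Relation.Unary.AllPairs.Properties as AllPairs
open import Data.List.Relation.Unary.Any using (Any; here; there; any?)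
open import Data.List.Relation.Unary.Linked using (Linked; _∷_)
open import Data.Nat as ℕ using (ℕ; zero; suc; _∸_; _+_; _*_; _≤_; _<_; z≤n)
open import Data.Nat.DivMod using (_%_; m<n⇒m%n≡m; [m+kn]%n≡m%n)
open import Data.Nat.Induction using (<-wellFounded)
open import Data.Nat.ListAction using (sum)
open import Data.Nat.ListAction.Properties using (sum-↭; sum-++)
import Data.Nat.Properties as ℕP
import Data.Nat.Tactic.RingSolver as NS
open import Data.Product using (∃; _×_; _,_; proj₁; proj₂)
open import Data.Sign using (Sign)
open import Data.Sum using (_⊎_; inj₁; inj₂)
open import Function using (id; _∘_; _on_)
open import Induction.WellFounded using (Acc; acc)
import Relation.Binary.Construct.On as On
open import Relation.Binary.PropositionalEquality
open import Relation.Nullary.Decidable using (Dec; yes; no; map′; _⊎-dec_)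
open import Relation.Unary using (Pred; Decidable)

least : ∀ {p} {P : Pred ℕ p} → Decidable P → ∀ {n} → P n →
        ∃ λ m → P m × (∀ m′ → P m′ → m ≤ m′)
least {P = P} P? {n} = go n (<-wellFounded n)
  where
  go : ∀ n → Acc _<_ n → P n → ∃ λ m → P m × (∀ m′ → P m′ → m ≤ m′)
  go n (acc below) Pn with ℕP.anyUpTo? P? n
  ... | yes (m , m<n , Pm) = go m (below m<n) Pm
  ... | no ∄m<n            = n , Pn , λ m Pm → ℕP.≮⇒≥ (λ m<n → ∄m<n (m , m<n , Pm))

module _ {D : List ℕ} where

  Adjacent-sym : ∀ {u v} → Adjacent D u v → Adjacent D v u
  Adjacent-sym {u} {v} (d , d∈D , ∣u-v∣≡d) = d , d∈D , trans (ℤP.∣i-j∣≡∣j-i∣ v u) ∣u-v∣≡d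

  Adjacent-neg : ∀ {u v} → Adjacent D u v → Adjacent D (ℤ.- u) (ℤ.- v)
  Adjacent-neg {u} {v} (d , d∈D , ∣u-v∣≡d) = d , d∈D , (begin
    ∣ ℤ.- u ℤ.- ℤ.- v ∣ ≡⟨ cong ∣_∣ (ℤP.neg-distrib-+ u (ℤ.- v)) ⟨
    ∣ ℤ.- (u ℤ.- v) ∣   ≡⟨ ℤP.∣-i∣≡∣i∣ (u ℤ.- v) ⟩
    ∣ u ℤ.- v ∣         ≡⟨ ∣u-v∣≡d ⟩
    d                   ∎)
    where open ≡-Reasoning

  infixr 5 _++ʷ_
  _++ʷ_ : ∀ {u v w m n} → Walk D u v m → Walk D v w n → Walk D u w (m + n)
  here     ++ʷ q = q
  step a p ++ʷ q = step a (p ++ʷ q)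

  infixl 5 _∷ʳʷ_
  _∷ʳʷ_ : ∀ {u v w n} → Walk D u v n → Adjacent D v w → Walk D u w (suc n)
  here     ∷ʳʷ a = step a here
  step b p ∷ʳʷ a = step b (p ∷ʳʷ a)

  reverseʷ : ∀ {u v n} → Walk D u v n → Walk D v u n
  reverseʷ here       = here
  reverseʷ {u} (step {v = w} a p) = reverseʷ p ∷ʳʷ Adjacent-sym {u} {w} a

  negateʷ : ∀ {u v n} → Walk D u v n → Walk D (ℤ.- u) (ℤ.- v) n
  negateʷ here       = here
  negateʷ {u} (step {v = w} a p) = step (Adjacent-neg {u} {w} a) (negateʷ p)

  straightʷ : ∀ {d} → d ∈ D → ∀ x m → Walk D (+ x) (+ (x + m * d)) m
  straightʷ d∈D x zero = subst (λ y → Walk D (+ x) (+ y) 0) (sym (ℕP.+-identityʳ x)) here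
  straightʷ {d} d∈D x (suc m) =
    step (d , d∈D , ∣x-[x+d]∣≡d)
         (subst (λ y → Walk D (+ (x + d)) (+ y) m) (ℕP.+-assoc x d (m * d)) (straightʷ d∈D (x + d) m))
    where
    open ≡-Reasoning
    ∣x-[x+d]∣≡d : ∣ + x ℤ.- + (x + d) ∣ ≡ d
    ∣x-[x+d]∣≡d = begin
      ∣ + x ℤ.- + (x + d) ∣ ≡⟨ cong ∣_∣ (ℤP.m-n≡m⊖n x (x + d)) ⟩
      ∣ x ℤ.⊖ (x + d) ∣     ≡⟨ ℤP.∣⊖∣-≤ (ℕP.m≤m+n x d) ⟩
      x + d ∸ x             ≡⟨ ℕP.m+n∸m≡n x d ⟩
      d                     ∎

  private
    u-[u-x]≡x : ∀ u x → u ℤ.- (u ℤ.- x) ≡ x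
    u-[u-x]≡x = ZS.solve-∀

    u-[u+x]≡-x : ∀ u x → u ℤ.- (u ℤ.+ x) ≡ ℤ.- x
    u-[u+x]≡-x = ZS.solve-∀

  neighbour : ∀ {u w d} → ∣ u ℤ.- w ∣ ≡ d → w ≡ u ℤ.- + d ⊎ w ≡ u ℤ.+ + d
  neighbour {u} {w} refl with ℤP.+∣i∣≡i⊎+∣i∣≡-i (u ℤ.- w)
  ... | inj₁ +∣u-w∣≡u-w  = inj₁ (trans (sym (u-[u-x]≡x u w)) (cong (λ x → u ℤ.- x) (sym +∣u-w∣≡u-w)))
  ... | inj₂ +∣u-w∣≡-u+w = inj₂ (trans (sym (u-[u-x]≡x u w)) (cong (λ x → u ℤ.+ x) (sym +∣u-w∣≡-u+w)))

  Adjacent-minus : ∀ {d} → d ∈ D → ∀ u → Adjacent D u (u ℤ.- + d)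
  Adjacent-minus {d} d∈D u = d , d∈D , cong ∣_∣ (u-[u-x]≡x u (+ d))

  Adjacent-plus : ∀ {d} → d ∈ D → ∀ u → Adjacent D u (u ℤ.+ + d)
  Adjacent-plus {d} d∈D u = d , d∈D , trans (cong ∣_∣ (u-[u+x]≡-x u (+ d))) (ℤP.∣-i∣≡∣i∣ (+ d))

  walk? : ∀ n u v → Dec (Walk D u v n)
  walk? zero    u v = map′ (λ { refl → here }) (λ { here → refl }) (u ℤP.≟ v)
  walk? (suc n) u v = map′ fromAny toAny (any? (λ d → walk? n (u ℤ.- + d) v ⊎-dec walk? n (u ℤ.+ + d) v) D)
    where
    ViaNeighbour : ℕ → Set
    ViaNeighbour d = Walk D (u ℤ.- + d) v n ⊎ Walk D (u ℤ.+ + d) v n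

    fromAny : Any ViaNeighbour D → Walk D u v (suc n)
    fromAny p with find p
    ... | d , d∈D , inj₁ q = step (Adjacent-minus d∈D u) q
    ... | d , d∈D , inj₂ q = step (Adjacent-plus d∈D u) q

    toAny : Walk D u v (suc n) → Any ViaNeighbour D
    toAny (step {v = w} (d , d∈D , ∣u-w∣≡d) q) with neighbour {u} {w} ∣u-w∣≡d
    ... | inj₁ refl = lose d∈D (inj₁ q)
    ... | inj₂ refl = lose d∈D (inj₂ q)

shortest-walk : ∀ {D u v n} → Walk D u v n → ∃ (IsDist D u v)
shortest-walk {D} {u} {v} = least (λ m → walk? m u v)

radio-walk : ∀ {D k c u v n} → IsRadioLabeling D k c → u ≢ v → Walk D u v n →
             k + 1 ≤ ∣ + c u ℤ.- + c v ∣ + n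
radio-walk rl u≢v p with shortest-walk p
... | m , dist@(_ , minimal) = ℕP.≤-trans (rl _ _ u≢v m dist) (ℕP.+-monoʳ-≤ _ (minimal _ p))

module Spread {A : Set} (k : ℕ) (label weight : A → ℕ) where

  Separated : A → A → Set
  Separated x y = k + 1 ≤ ∣ + label x ℤ.- + label y ∣ + (weight x + weight y)

  _≤ˡ_ : A → A → Set
  x ≤ˡ y = label x ≤ label y

  totalWeight : List A → ℕ
  totalWeight xs = sum (map weight xs)

  Separated-sym : ∀ {x y} → Separated x y → Separated y x
  Separated-sym {x} {y} = subst₂ (λ g w → k + 1 ≤ g + w)
    (ℤP.∣i-j∣≡∣j-i∣ (+ label x) (+ label y)) (ℕP.+-comm (weight x) (weight y))

  Separated⇒step : ∀ {x y} → x ≤ˡ y → Separated x y →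
                   label x + (k + 1) ≤ label y + (weight x + weight y)
  Separated⇒step {x} {y} x≤y x~y = begin
    label x + (k + 1)                                    ≤⟨ ℕP.+-monoʳ-≤ (label x) x~y ⟩
    label x + (∣ + label x ℤ.- + label y ∣ + w)          ≡⟨ cong (λ g → label x + (g + w)) gap ⟩
    label x + (label y ∸ label x + w)                    ≡⟨ ℕP.+-assoc (label x) _ w ⟨
    label x + (label y ∸ label x) + w                    ≡⟨ cong (_+ w) (ℕP.m+[n∸m]≡n x≤y) ⟩
    label y + w                                          ∎
    where
    open ℕP.≤-Reasoning
    w = weight x + weight y
    gap : ∣ + label x ℤ.- + label y ∣ ≡ label y ∸ label x
    gap = trans (cong ∣_∣ (ℤP.m-n≡m⊖n (label x) (label y))) (ℤP.∣⊖∣-≤ x≤y)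

  sorted-spread : ∀ {x xs} → Linked _≤ˡ_ (x ∷ xs) → AllPairs Separated (x ∷ xs) →
    ∃ λ z → label x + length xs * (k + 1) + weight x + weight z ≤ label z + 2 * totalWeight (x ∷ xs)
  sorted-spread {x} {[]} _ _ = x , ℕP.≤-reflexive (regroup (label x) (weight x) (k + 1))
    where
    regroup : ∀ l w K → l + 0 * K + w + w ≡ l + 2 * (w + 0)
    regroup = NS.solve-∀
  sorted-spread {x} {y ∷ ys} (x≤y ∷ sorted) ((x~y ∷ _) ∷ separated) with sorted-spread sorted separated
  ... | z , ih = z , (begin
    lx + (K + n * K) + wx + wz         ≡⟨ regroup₁ lx K (n * K) wx wz ⟩
    lx + K + (n * K + wx + wz)         ≤⟨ ℕP.+-monoˡ-≤ _ (Separated⇒step x≤y x~y) ⟩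
    ly + (wx + wy) + (n * K + wx + wz) ≡⟨ regroup₂ ly wx wy (n * K) wz ⟩
    ly + n * K + wy + wz + 2 * wx      ≤⟨ ℕP.+-monoˡ-≤ _ ih ⟩
    label z + 2 * W + 2 * wx           ≡⟨ regroup₃ (label z) W wx ⟩
    label z + 2 * (wx + W)             ∎)
    where
    open ℕP.≤-Reasoning
    lx = label x ; ly = label y ; wx = weight x ; wy = weight y ; wz = weight z
    K = k + 1 ; n = length ys ; W = totalWeight (y ∷ ys)
    regroup₁ : ∀ a b c d e → a + (b + c) + d + e ≡ a + b + (c + d + e)
    regroup₁ = NS.solve-∀
    regroup₂ : ∀ a b c d e → a + (b + c) + (d + b + e) ≡ a + d + c + e + 2 * b
    regroup₂ = NS.solve-∀
    regroup₃ : ∀ a b c → a + 2 * b + 2 * c ≡ a + 2 * (c + b)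
    regroup₃ = NS.solve-∀

  spread-sorted : ∀ {M} → (∀ x y → label x ≤ label y + M) → ∀ {xs} → Linked _≤ˡ_ xs →
                  AllPairs Separated xs → length xs * (k + 1) ≤ M + (k + 1) + 2 * totalWeight xs
  spread-sorted span {[]}     _      _         = z≤n
  spread-sorted {M} span {x ∷ xs} sorted separated with sorted-spread sorted separated
  ... | z , bound = ℕP.+-cancelˡ-≤ (label x) _ _ (begin
    label x + (K + n * K)              ≡⟨ regroup₁ (label x) K (n * K) ⟩
    K + (label x + n * K)              ≤⟨ ℕP.+-monoʳ-≤ K (ℕP.m+n≤o⇒m≤o _ (ℕP.m+n≤o⇒m≤o _ bound)) ⟩
    K + (label z + 2 * W)              ≤⟨ ℕP.+-monoʳ-≤ K (ℕP.+-monoˡ-≤ _ (span z x)) ⟩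
    K + (label x + M + 2 * W)          ≡⟨ regroup₂ K (label x) M (2 * W) ⟩
    label x + (M + K + 2 * W)          ∎)
    where
    open ℕP.≤-Reasoning
    K = k + 1 ; n = length xs ; W = totalWeight (x ∷ xs)
    regroup₁ : ∀ a b c → a + (b + c) ≡ b + (a + c)
    regroup₁ = NS.solve-∀
    regroup₂ : ∀ a b c d → a + (b + c + d) ≡ b + (c + a + d)
    regroup₂ = NS.solve-∀

  open import Data.List.Relation.Binary.Permutation.Setoid.Properties (setoid A) using (AllPairs-resp-↭)
  open import Data.List.Sort (On.decTotalOrder ℕP.≤-decTotalOrder label) using (sort; sort-↭; sort-↗)

  -- (length xs − 1)(k + 1) ≤ M + 2 · totalWeight xs, stated without truncated subtraction
  spread : ∀ {M} → (∀ x y → label x ≤ label y + M) → ∀ xs → AllPairs Separated xs →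
           length xs * (k + 1) ≤ M + (k + 1) + 2 * totalWeight xs
  spread {M} span xs separated =
    subst₂ (λ n W → n * (k + 1) ≤ M + (k + 1) + 2 * W)
      (↭-length sorted↭xs) (sum-↭ (↭-map⁺ weight sorted↭xs))
      (spread-sorted span (sort-↗ xs)
        (AllPairs-resp-↭ Separated-sym ((λ { refl → id }) , (λ { refl → id })) (↭⇒↭ₛ (↭-sym sorted↭xs)) separated))
    where sorted↭xs = sort-↭ xs

record Rooted (D : List ℕ) : Set where
  constructor rooted
  field
    vertex : ℤ
    depth  : ℕ
    walk   : Walk D (+ 0) vertex depth

open Rooted

negate : ∀ {D} → Rooted D → Rooted D
negate (rooted v n p) = rooted (ℤ.- v) n (negateʷ p)

radio-spread : ∀ {D k c M} → IsRadioLabeling D k c → SpanAtMost c M →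
               ∀ (ps : List (Rooted D)) → AllPairs (_≢_ on vertex) ps →
               length ps * (k + 1) ≤ M + (k + 1) + 2 * sum (map depth ps)
radio-spread {k = k} {c} rl span ps apart =
  Spread.spread k (c ∘ vertex) depth (λ p q → span (vertex p) (vertex q)) ps
    (AllPairs.map (λ {p} {q} v≢ → radio-walk {c = c} rl v≢ (reverseʷ (walk p) ++ʷ walk q)) apart)

module Consecutive (s : ℕ) where

  t : ℕ
  t = suc s

  D : List ℕ
  D = s ∷ t ∷ []

  magnitude-injective : ∀ {a a′ b b′} → a < t → a′ < t →
                        b * t + a * s ≡ b′ * t + a′ * s → a ≡ a′ × b ≡ b′
  magnitude-injective {a} {a′} {b} {b′} a<t a′<t eq = sym a′≡a , b≡b′
    where
    open ≡-Reasoning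
    rotate : ∀ a a′ b s → a′ + (b + a) * suc s ≡ b * suc s + a * s + (a + a′)
    rotate = NS.solve-∀
    -- b t + a s + a = (b + a) t, so a is recovered as a remainder modulo t
    shifted : a′ + (b + a) * t ≡ a + (b′ + a′) * t
    shifted = begin
      a′ + (b + a) * t             ≡⟨ rotate a a′ b s ⟩
      b * t + a * s + (a + a′)     ≡⟨ cong₂ _+_ eq (ℕP.+-comm a a′) ⟩
      b′ * t + a′ * s + (a′ + a)   ≡⟨ rotate a′ a b′ s ⟨
      a + (b′ + a′) * t            ∎
    a′≡a : a′ ≡ a
    a′≡a = begin
      a′                           ≡⟨ m<n⇒m%n≡m a′<t ⟨
      a′ % t                       ≡⟨ [m+kn]%n≡m%n a′ (b + a) t ⟨
      (a′ + (b + a) * t) % t       ≡⟨ cong (_% t) shifted ⟩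
      (a + (b′ + a′) * t) % t      ≡⟨ [m+kn]%n≡m%n a (b′ + a′) t ⟩
      a % t                        ≡⟨ m<n⇒m%n≡m a<t ⟩
      a                            ∎
    b≡b′ : b ≡ b′
    b≡b′ = ℕP.*-cancelʳ-≡ b b′ t
             (ℕP.+-cancelʳ-≡ (a * s) (b * t) (b′ * t) (trans eq (cong (λ x → b′ * t + x * s) a′≡a)))

  point : Sign → ℕ → ℕ → Rooted D
  point Sign.+ a b = rooted (+ (b * t + a * s)) (b + a)
                       (straightʷ (there (here refl)) 0 b ++ʷ straightʷ (here refl) (b * t) a)
  -- negative points start one level higher, so that the vertex 0 occurs only once
  point Sign.- a b = negate (point Sign.+ a (suc b))

  point-injective : ∀ σ σ′ {a a′ b b′} → a < t → a′ < t →
                    vertex (point σ a b) ≡ vertex (point σ′ a′ b′) → σ ≡ σ′ × a ≡ a′ × b ≡ b′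
  point-injective Sign.+ Sign.+ a<t a′<t eq
    with a≡a′ , b≡b′ ← magnitude-injective a<t a′<t (ℤP.+-injective eq) = refl , a≡a′ , b≡b′
  point-injective Sign.- Sign.- a<t a′<t eq
    with a≡a′ , b+1≡b′+1 ← magnitude-injective a<t a′<t (ℤP.+-injective (ℤP.neg-injective eq))
    = refl , a≡a′ , ℕP.suc-injective b+1≡b′+1
  point-injective Sign.+ Sign.- _ _ ()
  point-injective Sign.- Sign.+ _ _ ()

  block : ℕ → ℕ → List (Rooted D)
  block b zero    = []
  block b (suc a) = point Sign.+ a b ∷ point Sign.- a b ∷ block b a

  points : ℕ → List (Rooted D)
  points zero    = []
  points (suc b) = block b t ++ points b

  block-all : ∀ {P : Rooted D → Set} {b m} → (∀ σ a → a < m → P (point σ a b)) → All P (block b m)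
  block-all {m = zero}  _ = []
  block-all {m = suc a} P-point =
    P-point Sign.+ a ℕP.≤-refl ∷ P-point Sign.- a ℕP.≤-refl ∷
    block-all (λ σ a′ a′<a → P-point σ a′ (ℕP.m<n⇒m<1+n a′<a))

  points-all : ∀ {P : Rooted D → Set} {R} → (∀ σ a b → a < t → b < R → P (point σ a b)) →
               All P (points R)
  points-all {R = zero}  _ = []
  points-all {R = suc b} P-point =
    All.++⁺ (block-all (λ σ a a<t → P-point σ a b a<t ℕP.≤-refl))
            (points-all (λ σ a b′ a<t b′<b → P-point σ a b′ a<t (ℕP.m<n⇒m<1+n b′<b)))

  block-apart : ∀ b {m} → m ≤ t → AllPairs (_≢_ on vertex) (block b m)
  block-apart b {zero}  _   = []
  block-apart b {suc a} a<t = ((λ ()) ∷ later Sign.+) ∷ later Sign.- ∷ block-apart b (ℕP.<⇒≤ a<t)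
    where
    later : ∀ σ → All ((_≢_ on vertex) (point σ a b)) (block b a)
    later σ = block-all λ σ′ a′ a′<a eq →
      ℕP.<-irrefl (sym (proj₁ (proj₂ (point-injective σ σ′ a<t (ℕP.<-trans a′<a a<t) eq)))) a′<a

  points-apart : ∀ R → AllPairs (_≢_ on vertex) (points R)
  points-apart zero    = []
  points-apart (suc b) = AllPairs.++⁺ (block-apart b ℕP.≤-refl) (points-apart b)
    (block-all λ σ a a<t → points-all {R = b} λ σ′ a′ b′ a′<t b′<b eq →
      ℕP.<-irrefl (sym (proj₂ (proj₂ (point-injective σ σ′ a<t a′<t eq)))) b′<b)

  length-block : ∀ b m → length (block b m) ≡ m * 2
  length-block b zero    = refl
  length-block b (suc a) = cong (suc ∘ suc) (length-block b a)

  length-points : ∀ R → length (points R) ≡ R * (t * 2)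
  length-points zero    = refl
  length-points (suc b) = trans (Listₚ.length-++ (block b t)) (cong₂ _+_ (length-block b t) (length-points b))

  depth-block : ∀ b m → sum (map depth (block b m)) ≡ m * (2 * b + m)
  depth-block b zero    = refl
  depth-block b (suc a) = begin
    b + a + (suc b + a + sum (map depth (block b a))) ≡⟨ cong (λ w → b + a + (suc b + a + w)) (depth-block b a) ⟩
    b + a + (suc b + a + a * (2 * b + a))             ≡⟨ expand b a ⟩
    suc a * (2 * b + suc a)                           ∎
    where
    open ≡-Reasoning
    expand : ∀ b a → b + a + (suc b + a + a * (2 * b + a)) ≡ suc a * (2 * b + suc a)
    expand = NS.solve-∀

  depth-points : ∀ R → sum (map depth (points R)) ≡ R * (R + s) * t
  depth-points zero    = refl
  depth-points (suc b) = begin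
    sum (map depth (block b t ++ points b))                 ≡⟨ cong sum (Listₚ.map-++ depth (block b t) (points b)) ⟩
    sum (map depth (block b t) ++ map depth (points b))     ≡⟨ sum-++ (map depth (block b t)) _ ⟩
    sum (map depth (block b t)) + sum (map depth (points b)) ≡⟨ cong₂ _+_ (depth-block b t) (depth-points b) ⟩
    t * (2 * b + t) + b * (b + s) * t                        ≡⟨ expand b s ⟩
    suc b * (suc b + s) * t                                  ∎
    where
    open ≡-Reasoning
    expand : ∀ b s → suc s * (2 * b + suc s) + b * (b + s) * suc s ≡ suc b * (suc b + s) * suc s
    expand = NS.solve-∀

span-bound : ∀ {s k c M} R → IsRadioLabeling (s ∷ suc s ∷ []) k c → SpanAtMost c M →
             R * (suc s * 2) * (k + 1) ≤ M + (k + 1) + 2 * (R * (R + s) * suc s)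
span-bound {s} {k} {M = M} R rl span =
  subst₂ (λ n W → n * (k + 1) ≤ M + (k + 1) + 2 * W) (length-points R) (depth-points R)
    (radio-spread rl span (points R) (points-apart R))
  where open Consecutive s

parity : ∀ j → ∃ λ r → j ≡ r + r ⊎ j ≡ suc (r + r)
parity zero = 0 , inj₁ refl
parity (suc j) with parity j
... | r , inj₁ refl = r , inj₂ refl
... | r , inj₂ refl = suc r , inj₁ (cong suc (sym (ℕP.+-suc r r)))

half-split : ∀ j → ∃ λ R → ∃ λ R′ → R + R′ ≡ 2 + j × suc j * suc j + 2 ≤ 4 * (R * R′)
half-split j with parity j
... | r , inj₁ refl = suc r , suc r , even-sum r , ℕP.m+n≤o⇒m≤o _ (ℕP.≤-reflexive (even-square r))
  where
  even-sum : ∀ r → suc r + suc r ≡ 2 + (r + r)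
  even-sum = NS.solve-∀
  even-square : ∀ r → suc (r + r) * suc (r + r) + 2 + (4 * r + 1) ≡ 4 * (suc r * suc r)
  even-square = NS.solve-∀
... | r , inj₂ refl = suc r , suc (suc r) , odd-sum r , ℕP.m+n≤o⇒m≤o _ (ℕP.≤-reflexive (odd-square r))
  where
  odd-sum : ∀ r → suc r + suc (suc r) ≡ 2 + suc (r + r)
  odd-sum = NS.solve-∀
  odd-square : ∀ r → suc (suc (r + r)) * suc (suc (r + r)) + 2 + (4 * r + 2) ≡ 4 * (suc r * suc (suc r))
  odd-square = NS.solve-∀

quadratic-bound : ∀ {s j c M} → IsRadioLabeling (s ∷ suc s ∷ []) (suc s + j) c → SpanAtMost c M →
                  suc s * suc j * suc j ≤ 2 * M + 2 * suc j
quadratic-bound {s} {j} {M = M} rl span with half-split j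
... | R , R′ , R+R′≡2+j , split = ℕP.+-cancelʳ-≤ (2 * t) _ _ (begin
  t * suc j * suc j + 2 * t   ≡⟨ regroup₁ t (suc j) ⟩
  t * (suc j * suc j + 2)     ≤⟨ ℕP.*-monoʳ-≤ t split ⟩
  t * (4 * (R * R′))          ≡⟨ regroup₂ t R R′ ⟩
  2 * (R * (t * 2) * R′)      ≤⟨ ℕP.*-monoʳ-≤ 2 lower-bound ⟩
  2 * (M + (k + 1))           ≡⟨ regroup₃ M s j ⟩
  2 * M + 2 * suc j + 2 * t   ∎)
  where
  open ℕP.≤-Reasoning
  t = suc s
  k = t + j
  regroup₁ : ∀ t n → t * n * n + 2 * t ≡ t * (n * n + 2)
  regroup₁ = NS.solve-∀
  regroup₂ : ∀ t R R′ → t * (4 * (R * R′)) ≡ 2 * (R * (t * 2) * R′)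
  regroup₂ = NS.solve-∀
  regroup₃ : ∀ M s j → 2 * (M + (suc s + j + 1)) ≡ 2 * M + 2 * suc j + 2 * suc s
  regroup₃ = NS.solve-∀
  regroup₄ : ∀ R R′ s → 2 * (R * (R + s) * suc s) + R * (suc s * 2) * R′ ≡ R * (suc s * 2) * (s + (R + R′))
  regroup₄ = NS.solve-∀
  s+[2+j]≡k+1 : ∀ s j → s + (2 + j) ≡ suc s + j + 1
  s+[2+j]≡k+1 = NS.solve-∀
  lower-bound : R * (t * 2) * R′ ≤ M + (k + 1)
  lower-bound = ℕP.+-cancelˡ-≤ (2 * (R * (R + s) * t)) _ _ (begin
    2 * (R * (R + s) * t) + R * (t * 2) * R′  ≡⟨ regroup₄ R R′ s ⟩
    R * (t * 2) * (s + (R + R′))              ≡⟨ cong (λ x → R * (t * 2) * x) (trans (cong (λ x → s + x) R+R′≡2+j) (s+[2+j]≡k+1 s j)) ⟩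
    R * (t * 2) * (k + 1)                     ≤⟨ span-bound {k = k} R rl span ⟩
    M + (k + 1) + 2 * (R * (R + s) * t)       ≡⟨ ℕP.+-comm (M + (k + 1)) _ ⟩
    2 * (R * (R + s) * t) + (M + (k + 1))     ∎)

twiceBound-shift : ∀ t j → twiceBound t (t + j) ≡ + (t * suc j * suc j) ℤ.- + (2 * suc j)
twiceBound-shift t j = begin
  twiceBound t (t + j)                      ≡⟨ shift (+ t) (+ j) (+ (t + j)) (ℤP.pos-+ t j) ⟩
  quadratic (+ 1 ℤ.+ + j)                   ≡⟨ cong quadratic (ℤP.pos-+ 1 j) ⟨
  quadratic (+ suc j)                       ≡⟨ cong₂ ℤ._-_ casts (ℤP.pos-* 2 (suc j)) ⟨
  + (t * suc j * suc j) ℤ.- + (2 * suc j)   ∎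
  where
  open ≡-Reasoning
  quadratic : ℤ → ℤ
  quadratic S = + t ℤ.* S ℤ.* S ℤ.- + 2 ℤ.* S
  -- twiceBound T K, spelled out for the ring solver
  shift : ∀ T J K → K ≡ T ℤ.+ J →
          T ℤ.* K ℤ.* K
          ℤ.- + 2 ℤ.* (T ℤ.* T ℤ.- T ℤ.+ + 1) ℤ.* K
          ℤ.+ (T ℤ.* T ℤ.* T ℤ.- + 2 ℤ.* T ℤ.* T ℤ.+ + 3 ℤ.* T ℤ.- + 2)
          ≡ T ℤ.* (+ 1 ℤ.+ J) ℤ.* (+ 1 ℤ.+ J) ℤ.- + 2 ℤ.* (+ 1 ℤ.+ J)
  shift T J _ refl = ZS.solve (T List.∷ J List.∷ List.[])
  casts : + (t * suc j * suc j) ≡ + t ℤ.* + suc j ℤ.* + suc j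
  casts = trans (ℤP.pos-* (t * suc j) (suc j)) (cong (ℤ._* + suc j) (ℤP.pos-* t (suc j)))

twiceBound-≤ : ∀ t j M → t * suc j * suc j ≤ 2 * M + 2 * suc j → twiceBound t (t + j) ℤ.≤ + (2 * M)
twiceBound-≤ t j M h = begin
  twiceBound t (t + j)                              ≡⟨ twiceBound-shift t j ⟩
  + (t * suc j * suc j) ℤ.- + (2 * suc j)           ≤⟨ ℤP.+-monoˡ-≤ (ℤ.- + (2 * suc j)) (ℤ.+≤+ h) ⟩
  + (2 * M + 2 * suc j) ℤ.- + (2 * suc j)           ≡⟨ cong (λ x → x ℤ.- + (2 * suc j)) (ℤP.pos-+ (2 * M) (2 * suc j)) ⟩
  + (2 * M) ℤ.+ + (2 * suc j) ℤ.- + (2 * suc j)     ≡⟨ x+y-y≡x (+ (2 * M)) (+ (2 * suc j)) ⟩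
  + (2 * M)                                         ∎
  where
  open ℤP.≤-Reasoning
  x+y-y≡x : ∀ x y → x ℤ.+ y ℤ.- y ≡ x
  x+y-y≡x = ZS.solve-∀

-- The hypothesis 3 ≤ t is only used to write t = s + 1.
proposition3 : (t k : ℕ) → 3 ℕ.≤ t → t ℕ.≤ k →
    (c : ℤ → ℕ) → IsRadioLabeling (t ∸ 1 ∷ t ∷ []) k c →
    (M : ℕ) → SpanAtMost c M →
    twiceBound t k ℤ.≤ + (2 ℕ.* M)
proposition3 (suc s) k _ t≤k c rl M span with k ∸ suc s | ℕP.m+[n∸m]≡n t≤k
... | j | refl = twiceBound-≤ (suc s) j M (quadratic-bound rl span)
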